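{- For an integer $s>4$, let $C_s^{(2)}$ be the graph on the vertex set of the cycle $C_s$ in which two distinct vertices are adjacent iff their distance in $C_s$ is at most $2$. Then $C_s^{(2)}$ is $4$-regular and its edge-connectivity is $4$. Moreover, if $s>36$ then $m(C_s^{(2)})\le 2^3=8$.
   Context: The symmetric difference of two graphs $G_1=(V,E_1)$, $G_2=(V,E_2)$ on the same vertex set is $(V,E_1\oplus E_2)$, where $E_1\oplus E_2$ is the set of edges in exactly one of $E_1,E_2$. A connectivity code for a graph $H$ is a collection $\mathcal G$ of spanning subgraphs of $H$ such that the symmetric difference of any two distinct members is a connected spanning subgraph of $H$; $m(H)$ is the maximum cardinality of a connectivity code for $H$. -}

module Defs where

open import Data.Bool using (Bool; true; false; _∧_; _xor_; not; if_then_else_)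
open import Data.Nat using (ℕ; _≤_; _<_; _∸_; _≤ᵇ_; _≡ᵇ_; _<ᵇ_; ∣_-_∣; _⊓_)
open import Data.Fin using (Fin; toℕ)
open import Data.List using (List; length; filterᵇ; concatMap; map)
open import Data.List.Base using (allFin)
open import Data.Product using (Σ; _×_; _,_)
open import Relation.Binary.PropositionalEquality using (_≡_; _≢_)
open import Relation.Binary.Construct.Closure.ReflexiveTransitive using (Star)
open import Relation.Nullary using (¬_)

-- A (simple, undirected) graph on the vertex set Fin n, given by its
-- Boolean adjacency function (symmetry / irreflexivity stated separately).
Graph : ℕ → Set
Graph n = Fin n → Fin n → Bool

cycleDist : (s : ℕ) → Fin s → Fin s → ℕ
cycleDist s i j = ∣ toℕ i - toℕ j ∣ ⊓ (s ∸ ∣ toℕ i - toℕ j ∣)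

C2 : (s : ℕ) → Graph s
C2 s i j = not (toℕ i ≡ᵇ toℕ j) ∧ (cycleDist s i j ≤ᵇ 2)

degree : ∀ {n} → Graph n → Fin n → ℕ
degree {n} G v = length (filterᵇ (G v) (allFin n))

Regular : ∀ {n} → Graph n → ℕ → Set
Regular {n} G r = (v : Fin n) → degree G v ≡ r

SpanningSubgraph : ∀ {n} → Graph n → Graph n → Set
SpanningSubgraph {n} H G =
  ((u v : Fin n) → G u v ≡ G v u) × ((u v : Fin n) → G u v ≡ true → H u v ≡ true)

Adj : ∀ {n} → Graph n → Fin n → Fin n → Set
Adj G u v = G u v ≡ true

Connected : ∀ {n} → Graph n → Set
Connected {n} G = (u v : Fin n) → Star (Adj G) u v

_⊕_ : ∀ {n} → Graph n → Graph n → Graph n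
(G ⊕ G′) u v = G u v xor G′ u v

edgeCount : ∀ {n} → Graph n → ℕ
edgeCount {n} G =
  length (filterᵇ (λ p → PairOK p) (concatMap (λ i → map (λ j → i , j) (allFin n)) (allFin n)))
  where
    PairOK : Σ (Fin n) (λ _ → Fin n) → Bool
    PairOK (i , j) = (toℕ i <ᵇ toℕ j) ∧ G i j

_∖_ : ∀ {n} → Graph n → Graph n → Graph n
(H ∖ F) u v = H u v ∧ not (F u v)

EdgeCut : ∀ {n} → Graph n → Graph n → Set
EdgeCut H F = SpanningSubgraph H F × ¬ Connected (H ∖ F)

EdgeConnectivity : ∀ {n} → Graph n → ℕ → Set
EdgeConnectivity {n} H k =
  Σ (Graph n) (λ F → EdgeCut H F × edgeCount F ≡ k)
  × ((F : Graph n) → EdgeCut H F → k ≤ edgeCount F)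

-- a connectivity code for H of cardinality k, given as an indexed family
-- of spanning subgraphs; distinct members = distinct indices (members at
-- distinct indices are automatically distinct graphs, since their
-- symmetric difference is connected hence nonempty when n ≥ 2)
ConnectivityCode : ∀ {n} → Graph n → (k : ℕ) → (Fin k → Graph n) → Set
ConnectivityCode {n} H k 𝒢 =
  ((a : Fin k) → SpanningSubgraph H (𝒢 a))
  × ((a b : Fin k) → a ≢ b → Connected (𝒢 a ⊕ 𝒢 b))

mAtMost : ∀ {n} → Graph n → ℕ → Set
mAtMost {n} H M = (k : ℕ) (𝒢 : Fin k → Graph n) → ConnectivityCode H k 𝒢 → k ≤ M

{-# OPTIONS --safe #-}

-- C_s^(2) is 4-regular because the neighbours of v are v ± 1 and v ± 2, and the four edges at a
-- vertex form a cut.  Conversely, delete at most three edges.  For each x, either x and x + 1 stay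
-- joined by a short detour inside the window x − 2, …, x + 3, or no rim edge z — z + 1 other than
-- x — x + 1 was deleted; in both cases walking along the rim connects every pair of vertices.
--
-- For a connectivity code, record for every member G and vertex p which of the three chords
-- p — p + 1, p − 1 — p + 1, p — p + 2 lie in G.  If two members agree on this signature at p < p′,
-- no edge of their symmetric difference leaves the arc p + 1, …, p′, so it is disconnected.  With nine
-- members and 37 vertices, the pigeonhole principle applied to the 8 signatures at each vertex, and
-- then to the 36 pairs of members, produces such an agreement.

module Submission where

open import Defs
open import Data.Bool using (Bool; true; false; _∧_; _∨_; _xor_; not; if_then_else_; T)
import Data.Bool.Properties as Bool
open import Data.Bool.Properties using (T-≡; xor-same; ∧-conicalˡ; ∧-conicalʳ; ∨-comm; ∨-identityʳ)
open import Data.Fin as Fin using (Fin; toℕ; fromℕ<; inject≤; #_)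
open import Data.Fin.Properties
  using (toℕ-injective; toℕ<n; toℕ-fromℕ<; toℕ-inject≤; inject≤-injective; pigeonhole; any?; all?)
open import Data.List using (List; []; _∷_; _++_; length; lookup; map; filterᵇ; allFin; concatMap; cartesianProduct)
open import Data.List.Properties using (length-map)
open import Data.List.Membership.Propositional using (_∈_)
open import Data.List.Membership.Propositional.Properties
  using (∈-lookup; ∈-filter⁺; ∈-filter⁻; ∈-allFin; ∈-cartesianProduct⁺; ∈-map⁺; ∈-map⁻)
open import Data.List.Relation.Binary.Subset.Propositional using (_⊆_)
open import Data.List.Relation.Unary.All as All using (All; []; _∷_)
open import Data.List.Relation.Unary.AllPairs using ([]; _∷_)
open import Data.List.Relation.Unary.Any using (here; there; index)
open import Data.List.Relation.Unary.Any.Properties using (lookup-index)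
open import Data.List.Relation.Unary.Unique.Propositional using (Unique)
open import Data.List.Relation.Unary.Unique.Propositional.Properties using (filter⁺; allFin⁺; cartesianProduct⁺; map⁺)
open import Data.Nat using (ℕ; zero; suc; _+_; _∸_; _^_; _≤_; _<_; s≤s; z≤n; _≟_; _≤?_; _<?_; _≡ᵇ_; _≤ᵇ_; _<ᵇ_; ∣_-_∣; _⊓_)
open import Data.Nat.Properties
open import Algebra.Properties.CommutativeSemigroup +-commutativeSemigroup using (xy∙z≈xz∙y)
open import Data.Product using (Σ; ∃₂; _×_; _,_; proj₁; proj₂)
import Data.Product.Properties as Product
open import Data.Sum using (_⊎_; inj₁; inj₂; swap; [_,_]′)
open import Data.Unit using (tt)
open import Function using (_∘_; id)
open import Function.Bundles using (_⇔_; mk⇔; Equivalence)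
open import Relation.Binary.Construct.Closure.ReflexiveTransitive using (Star; ε; _◅_; _◅◅_; reverse)
open import Relation.Binary.Definitions using (DecidableEquality; tri<; tri≈; tri>)
open import Relation.Binary.PropositionalEquality
open import Relation.Nullary using (¬_; yes; no; contradiction)
open import Relation.Nullary.Decidable using (True; toWitness; T?; ¬?; _×-dec_; _→-dec_)

module _ {A : Set} where

  pigeonhole-∈ : ∀ {n} (xs : List A) → length xs < n → (f : Fin n → A) → (∀ i → f i ∈ xs) →
                 ∃₂ λ i j → i Fin.< j × f i ≡ f j
  pigeonhole-∈ xs lt f f∈xs with pigeonhole lt (λ i → index (f∈xs i))
  ... | i , j , i<j , same-index =
    i , j , i<j , trans (lookup-index (f∈xs i)) (trans (cong (lookup xs) same-index) (sym (lookup-index (f∈xs j))))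

  Unique⇒lookup-injective : ∀ {xs : List A} → Unique xs → ∀ {i j} → i Fin.< j → lookup xs i ≢ lookup xs j
  Unique⇒lookup-injective (x∉xs ∷ _) {Fin.zero} {Fin.suc j} _ = All.lookup x∉xs (∈-lookup j)
  Unique⇒lookup-injective (_ ∷ u) {Fin.suc i} {Fin.suc j} (s≤s i<j) = Unique⇒lookup-injective u i<j

  Unique-⊆⇒length≤ : ∀ {xs ys : List A} → Unique xs → xs ⊆ ys → length xs ≤ length ys
  Unique-⊆⇒length≤ {xs} {ys} unique xs⊆ys = ≮⇒≥ λ ys-shorter →
    let i , j , i<j , eq = pigeonhole-∈ ys ys-shorter (lookup xs) (xs⊆ys ∘ ∈-lookup)
    in Unique⇒lookup-injective unique i<j eq

  length-filterᵇ≡ : ∀ (p : A → Bool) {xs ys : List A} → Unique xs → Unique ys →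
                    (∀ {z} → z ∈ ys → z ∈ xs × p z ≡ true) → (∀ {z} → z ∈ xs → p z ≡ true → z ∈ ys) →
                    length (filterᵇ p xs) ≡ length ys
  length-filterᵇ≡ p uxs uys ys⊆ filter⊆ = ≤-antisym
    (Unique-⊆⇒length≤ (filter⁺ (T? ∘ p) uxs) λ z∈ →
      let z∈xs , pz = ∈-filter⁻ (T? ∘ p) z∈ in filter⊆ z∈xs (Equivalence.to T-≡ pz))
    (Unique-⊆⇒length≤ uys λ z∈ →
      let z∈xs , pz = ys⊆ z∈ in ∈-filter⁺ (T? ∘ p) z∈xs (Equivalence.from T-≡ pz))

bools : List Bool
bools = true ∷ false ∷ []

∈-bools : ∀ b → b ∈ bools
∈-bools true  = here refl
∈-bools false = there (here refl)

-- Rot s d a b : b ≡ a + d (mod s) with at most one wrap-around; used for a, b < s and d ≤ s.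
data Rot (s d a b : ℕ) : Set where
  direct : a + d ≡ b     → Rot s d a b
  wrap   : a + d ≡ b + s → Rot s d a b

module _ {s : ℕ} where

  Rot-zero : ∀ {a} → Rot s 0 a a
  Rot-zero = direct (+-identityʳ _)

  Rot-functional : ∀ {d a b b′} → b < s → b′ < s → Rot s d a b → Rot s d a b′ → b ≡ b′
  Rot-functional _   _    (direct e) (direct e′) = trans (sym e) e′
  Rot-functional b<s _    (direct e) (wrap e′)   = contradiction (trans (sym e) e′) (<⇒≢ (<-≤-trans b<s (m≤n+m _ _)))
  Rot-functional _   b′<s (wrap e)   (direct e′) = contradiction (trans (sym e′) e) (<⇒≢ (<-≤-trans b′<s (m≤n+m _ _)))
  Rot-functional _   _    (wrap e)   (wrap e′)   = +-cancelʳ-≡ s _ _ (trans (sym e) e′)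

  Rot-offset-unique : ∀ {d d′ a b} → d < s → d′ < s → Rot s d a b → Rot s d′ a b → d ≡ d′
  Rot-offset-unique _   _    (direct e) (direct e′) = +-cancelˡ-≡ _ _ _ (trans e (sym e′))
  Rot-offset-unique _   d′<s (direct e) (wrap e′)   = contradiction (wrapped-offset e e′) (<⇒≱ d′<s)
    where
    wrapped-offset : ∀ {a b d d′} → a + d ≡ b → a + d′ ≡ b + s → s ≤ d′
    wrapped-offset {a} {b} {d} {d′} e e′ = ≤-trans (m≤n+m s d) (≤-reflexive (+-cancelˡ-≡ a _ _
      (trans (sym (+-assoc a d s)) (trans (cong (_+ s) e) (sym e′)))))
  Rot-offset-unique d<s d′<s (wrap e) (direct e′) = sym (Rot-offset-unique d′<s d<s (direct e′) (wrap e))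
  Rot-offset-unique _   _    (wrap e)   (wrap e′)   = +-cancelˡ-≡ _ _ _ (trans e (sym e′))

  Rot-inverse : ∀ {d a b} → d ≤ s → Rot s d a b → Rot s (s ∸ d) b a
  Rot-inverse {d} {a} {b} d≤s (direct e) = wrap (begin
    b + (s ∸ d)      ≡⟨ cong (_+ (s ∸ d)) (sym e) ⟩
    a + d + (s ∸ d)  ≡⟨ +-assoc a d (s ∸ d) ⟩
    a + (d + (s ∸ d)) ≡⟨ cong (a +_) (m+[n∸m]≡n d≤s) ⟩
    a + s            ∎)
    where open ≡-Reasoning
  Rot-inverse {d} {a} {b} d≤s (wrap e) = direct (+-cancelʳ-≡ d _ _ (begin
    b + (s ∸ d) + d   ≡⟨ +-assoc b (s ∸ d) d ⟩
    b + (s ∸ d + d)   ≡⟨ cong (b +_) (m∸n+n≡m d≤s) ⟩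
    b + s             ≡⟨ sym e ⟩
    a + d             ∎))
    where open ≡-Reasoning

  Rot-compose : ∀ {d e a b c} → a < s → d + e ≤ s → Rot s d a b → Rot s e b c → Rot s (d + e) a c
  Rot-compose {d} {e} {a} _ _ (direct x) (direct y) = direct (trans (sym (+-assoc a d e)) (trans (cong (_+ e) x) y))
  Rot-compose {d} {e} {a} _ _ (direct x) (wrap y)   = wrap (trans (sym (+-assoc a d e)) (trans (cong (_+ e) x) y))
  Rot-compose {d} {e} {a} {b} _ _ (wrap x) (direct y) = wrap (begin
    a + (d + e)  ≡⟨ sym (+-assoc a d e) ⟩
    a + d + e    ≡⟨ cong (_+ e) x ⟩
    b + s + e    ≡⟨ xy∙z≈xz∙y b s e ⟩
    b + e + s    ≡⟨ cong (_+ s) y ⟩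
    _ + s        ∎)
    where open ≡-Reasoning
  Rot-compose {d} {e} {a} {b} {c} a<s d+e≤s (wrap x) (wrap y) = contradiction twice-wrapped (<⇒≱ (+-mono-<-≤ a<s d+e≤s))
    where
    open ≤-Reasoning
    twice-wrapped : s + s ≤ a + (d + e)
    twice-wrapped = begin
      s + s        ≤⟨ m≤n+m (s + s) c ⟩
      c + (s + s)  ≡⟨ sym (+-assoc c s s) ⟩
      c + s + s    ≡⟨ cong (_+ s) (sym y) ⟩
      b + e + s    ≡⟨ xy∙z≈xz∙y b e s ⟩
      b + s + e    ≡⟨ cong (_+ e) (sym x) ⟩
      a + d + e    ≡⟨ +-assoc a d e ⟩
      a + (d + e)  ∎

  Rot-cancelˡ : ∀ {k k′ x p q} → k ≤ k′ → q < s → Rot s k x p → Rot s k′ x q → Rot s (k′ ∸ k) p q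
  Rot-cancelˡ {k} {k′} {x} {p} {q} k≤k′ q<s = cancel
    where
    split : x + k′ ≡ x + k + (k′ ∸ k)
    split = trans (cong (x +_) (sym (m+[n∸m]≡n k≤k′))) (sym (+-assoc x k (k′ ∸ k)))

    cancel : Rot s k x p → Rot s k′ x q → Rot s (k′ ∸ k) p q
    cancel (direct e) (direct e′) = direct (trans (cong (_+ (k′ ∸ k)) (sym e)) (trans (sym split) e′))
    cancel (direct e) (wrap e′)   = wrap (trans (cong (_+ (k′ ∸ k)) (sym e)) (trans (sym split) e′))
    cancel (wrap e)   (wrap e′)   = direct (+-cancelʳ-≡ s _ _ (begin
      p + (k′ ∸ k) + s  ≡⟨ xy∙z≈xz∙y p (k′ ∸ k) s ⟩
      p + s + (k′ ∸ k)  ≡⟨ cong (_+ (k′ ∸ k)) (sym e) ⟩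
      x + k + (k′ ∸ k)  ≡⟨ sym split ⟩
      x + k′            ≡⟨ e′ ⟩
      q + s             ∎))
      where open ≡-Reasoning
    cancel (wrap e)   (direct e′) = contradiction (begin
      s                 ≤⟨ m≤n+m s p ⟩
      p + s             ≤⟨ m≤m+n (p + s) (k′ ∸ k) ⟩
      p + s + (k′ ∸ k)  ≡⟨ cong (_+ (k′ ∸ k)) (sym e) ⟩
      x + k + (k′ ∸ k)  ≡⟨ sym split ⟩
      x + k′            ≡⟨ e′ ⟩
      q                 ∎) (<⇒≱ q<s)
      where open ≤-Reasoning

C2≡true⇔ : ∀ {s} {u v : Fin s} → C2 s u v ≡ true ⇔ (toℕ u ≢ toℕ v × cycleDist s u v ≤ 2)
C2≡true⇔ {s} {u} {v} = mk⇔ to from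
  where
  to : C2 s u v ≡ true → toℕ u ≢ toℕ v × cycleDist s u v ≤ 2
  to adj with toℕ u ≡ᵇ toℕ v in u≡ᵇv | cycleDist s u v ≤ᵇ 2 in close
  ... | false | true = (λ u≡v → subst T u≡ᵇv (≡⇒≡ᵇ _ _ u≡v)) , ≤ᵇ⇒≤ _ 2 (subst T (sym close) tt)
  from : toℕ u ≢ toℕ v × cycleDist s u v ≤ 2 → C2 s u v ≡ true
  from (u≢v , d≤2) with toℕ u ≡ᵇ toℕ v in u≡ᵇv | cycleDist s u v ≤ᵇ 2 in close
  ... | true  | _     = contradiction (≡ᵇ⇒≡ _ _ (subst T (sym u≡ᵇv) tt)) u≢v
  ... | false | false = contradiction (subst T close (≤⇒≤ᵇ d≤2)) λ ()
  ... | false | true  = refl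

C2-sym : ∀ {s} (u v : Fin s) → C2 s u v ≡ C2 s v u
C2-sym {s} u v = cong₂ (λ e D → not e ∧ (D ⊓ (s ∸ D) ≤ᵇ 2)) (≡ᵇ-sym (toℕ u) (toℕ v)) (∣-∣-comm (toℕ u) (toℕ v))
  where
  ≡ᵇ-sym : ∀ a b → (a ≡ᵇ b) ≡ (b ≡ᵇ a)
  ≡ᵇ-sym zero    zero    = refl
  ≡ᵇ-sym zero    (suc b) = refl
  ≡ᵇ-sym (suc a) zero    = refl
  ≡ᵇ-sym (suc a) (suc b) = ≡ᵇ-sym a b

Ahead : ℕ → ℕ → ℕ → Set
Ahead s a b = Σ ℕ λ d → 1 ≤ d × d ≤ 2 × Rot s d a b

Rot⇒≢ : ∀ {s d a b} → 1 ≤ d → d < s → Rot s d a b → a ≢ b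
Rot⇒≢ 1≤d d<s a→b refl = <⇒≢ 1≤d (Rot-offset-unique (≤-<-trans z≤n d<s) d<s Rot-zero a→b)

Rot⇒cycleDist≤ : ∀ {s d a b} → d ≤ s → Rot s d a b → ∣ a - b ∣ ⊓ (s ∸ ∣ a - b ∣) ≤ d
Rot⇒cycleDist≤ {s} {d} {a} _ (direct refl) rewrite ∣m-m+n∣≡n a d = m⊓n≤m d (s ∸ d)
Rot⇒cycleDist≤ {s} {d} {a} {b} d≤s (wrap e) =
  subst (λ D → D ⊓ (s ∸ D) ≤ d) (sym ∣a-b∣≡s∸d) (subst (λ x → (s ∸ d) ⊓ x ≤ d) (sym (m∸[m∸n]≡n d≤s)) (m⊓n≤n (s ∸ d) d))
  where
  open ≡-Reasoning
  ∣a-b∣≡s∸d : ∣ a - b ∣ ≡ s ∸ d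
  ∣a-b∣≡s∸d = begin
    ∣ a - b ∣          ≡⟨ sym (∣m+n-m+o∣≡∣n-o∣ d a b) ⟩
    ∣ d + a - d + b ∣  ≡⟨ cong₂ ∣_-_∣ (trans (+-comm d a) e) (+-comm d b) ⟩
    ∣ b + s - b + d ∣  ≡⟨ ∣m+n-m+o∣≡∣n-o∣ b s d ⟩
    ∣ s - d ∣          ≡⟨ m≤n⇒∣n-m∣≡n∸m d≤s ⟩
    s ∸ d              ∎

Ahead⇒C2 : ∀ {s} {u v : Fin s} → 2 < s → Ahead s (toℕ u) (toℕ v) → C2 s u v ≡ true
Ahead⇒C2 2<s (d , 1≤d , d≤2 , u→v) = Equivalence.from C2≡true⇔
  (Rot⇒≢ 1≤d (≤-<-trans d≤2 2<s) u→v , ≤-trans (Rot⇒cycleDist≤ (≤-trans d≤2 (<⇒≤ 2<s)) u→v) d≤2)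

Ahead⇒C2ᵒ : ∀ {s} {u v : Fin s} → 2 < s → Ahead s (toℕ v) (toℕ u) → C2 s u v ≡ true
Ahead⇒C2ᵒ {u = u} {v} 2<s v→u = trans (C2-sym u v) (Ahead⇒C2 2<s v→u)

private
  gap⇒Ahead : ∀ {s a b} → a < b → b < s → (b ∸ a) ⊓ (s ∸ (b ∸ a)) ≤ 2 → Ahead s a b ⊎ Ahead s b a
  gap⇒Ahead {s} {a} {b} a<b b<s close with ⊓-sel (b ∸ a) (s ∸ (b ∸ a))
  ... | inj₁ eq = inj₁ (b ∸ a , m<n⇒0<n∸m a<b , subst (_≤ 2) eq close , direct (m+[n∸m]≡n (<⇒≤ a<b)))
  ... | inj₂ eq = inj₂ (s ∸ D , m<n⇒0<n∸m D<s , subst (_≤ 2) eq close , wrap (+-cancelʳ-≡ D _ _ (begin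
      b + (s ∸ D) + D  ≡⟨ +-assoc b (s ∸ D) D ⟩
      b + (s ∸ D + D)  ≡⟨ cong (b +_) (m∸n+n≡m (<⇒≤ D<s)) ⟩
      b + s            ≡⟨ cong (_+ s) (sym (m+[n∸m]≡n (<⇒≤ a<b))) ⟩
      a + D + s        ≡⟨ xy∙z≈xz∙y a D s ⟩
      a + s + D        ∎)))
    where
    open ≡-Reasoning
    D = b ∸ a
    D<s : D < s
    D<s = ≤-<-trans (m∸n≤m b a) b<s

C2⇒Ahead : ∀ {s} {u v : Fin s} → C2 s u v ≡ true → Ahead s (toℕ u) (toℕ v) ⊎ Ahead s (toℕ v) (toℕ u)
C2⇒Ahead {s} {u} {v} adj with Equivalence.to C2≡true⇔ adj | <-cmp (toℕ u) (toℕ v)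
... | u≢v , _     | tri≈ _ u≡v _ = contradiction u≡v u≢v
... | _   , close | tri< u<v _ _ =
  gap⇒Ahead u<v (toℕ<n v) (subst (λ D → D ⊓ (s ∸ D) ≤ 2) (m≤n⇒∣m-n∣≡n∸m (<⇒≤ u<v)) close)
... | _   , close | tri> _ _ v<u =
  swap (gap⇒Ahead v<u (toℕ<n u) (subst (λ D → D ⊓ (s ∸ D) ≤ 2) (m≤n⇒∣n-m∣≡n∸m (<⇒≤ v<u)) close))

pairs : (n : ℕ) → List (Fin n × Fin n)
pairs n = cartesianProduct (allFin n) (allFin n)

∈-pairs : ∀ {n} (i j : Fin n) → (i , j) ∈ pairs n
∈-pairs i j = ∈-cartesianProduct⁺ (∈-allFin i) (∈-allFin j)

pairs-unique : ∀ n → Unique (pairs n)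
pairs-unique n = cartesianProduct⁺ (allFin⁺ n) (allFin⁺ n)

listedEdge : ∀ {n} → Graph n → Fin n × Fin n → Bool
listedEdge G (i , j) = (toℕ i <ᵇ toℕ j) ∧ G i j

edgeCount≡ : ∀ {n} (G : Graph n) → edgeCount G ≡ length (filterᵇ (listedEdge G) (pairs n))
edgeCount≡ {n} G = cong (length ∘ filterᵇ (listedEdge G)) (concatMap-pairs (allFin n) (allFin n))
  where
  concatMap-pairs : ∀ {A B : Set} (xs : List A) (ys : List B) →
                    concatMap (λ x → map (x ,_) ys) xs ≡ cartesianProduct xs ys
  concatMap-pairs []       ys = refl
  concatMap-pairs (x ∷ xs) ys = cong (map (x ,_) ys ++_) (concatMap-pairs xs ys)

orient : ∀ {n} → Fin n × Fin n → Fin n × Fin n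
orient (u , v) = if toℕ u <ᵇ toℕ v then (u , v) else (v , u)

orient-injective : ∀ {n} {u v u′ v′ : Fin n} → orient (u , v) ≡ orient (u′ , v′) →
                   (u ≡ u′ × v ≡ v′) ⊎ (u ≡ v′ × v ≡ u′)
orient-injective {u = u} {v} {u′} {v′} eq with toℕ u <ᵇ toℕ v | toℕ u′ <ᵇ toℕ v′
... | true  | true  = inj₁ (cong proj₁ eq , cong proj₂ eq)
... | true  | false = inj₂ (cong proj₁ eq , cong proj₂ eq)
... | false | true  = inj₂ (cong proj₂ eq , cong proj₁ eq)
... | false | false = inj₁ (cong proj₂ eq , cong proj₁ eq)

orient-listed : ∀ {n} (F : Graph n) → (∀ u v → F u v ≡ F v u) →
                ∀ {u v} → toℕ u ≢ toℕ v → F u v ≡ true → listedEdge F (orient (u , v)) ≡ true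
orient-listed F F-sym {u} {v} u≢v Fuv with toℕ u <ᵇ toℕ v in u<ᵇv
... | true  = cong₂ _∧_ u<ᵇv Fuv
... | false = cong₂ _∧_ (Equivalence.to T-≡ (<⇒<ᵇ v<u)) (trans (F-sym v u) Fuv)
  where
  v<u : toℕ v < toℕ u
  v<u = ≤∧≢⇒< (≮⇒≥ λ u<v → subst T u<ᵇv (<⇒<ᵇ u<v)) (≢-sym u≢v)

edgeCount-≥ : ∀ {A : Set} {n} (F : Graph n) → (∀ u v → F u v ≡ F v u) →
              (edge : A → Fin n × Fin n) → (∀ {a b} → orient (edge a) ≡ orient (edge b) → a ≡ b) →
              (as : List A) → Unique as →
              All (λ a → toℕ (proj₁ (edge a)) ≢ toℕ (proj₂ (edge a)) × F (proj₁ (edge a)) (proj₂ (edge a)) ≡ true) as →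
              length as ≤ edgeCount F
edgeCount-≥ {n = n} F F-sym edge edge-injective as unique as⊆F = begin
  length as                                   ≡⟨ length-map (orient ∘ edge) as ⟨
  length (map (orient ∘ edge) as)             ≤⟨ Unique-⊆⇒length≤ (map⁺ edge-injective unique) listed ⟩
  length (filterᵇ (listedEdge F) (pairs n))   ≡⟨ edgeCount≡ F ⟨
  edgeCount F                                 ∎
  where
  open ≤-Reasoning
  listed : ∀ {e} → e ∈ map (orient ∘ edge) as → e ∈ filterᵇ (listedEdge F) (pairs n)
  listed e∈ with ∈-map⁻ (orient ∘ edge) e∈
  ... | _ , a∈as , refl = let u≢v , Fuv = All.lookup as⊆F a∈as in
    ∈-filter⁺ (T? ∘ listedEdge F) (∈-pairs _ _) (Equivalence.from T-≡ (orient-listed F F-sym u≢v Fuv))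

increasingPairs : (n : ℕ) → List (Fin n × Fin n)
increasingPairs n = filterᵇ (λ (a , b) → toℕ a <ᵇ toℕ b) (pairs n)

∈-increasingPairs : ∀ {n} {a b : Fin n} → toℕ a < toℕ b → (a , b) ∈ increasingPairs n
∈-increasingPairs a<b = ∈-filter⁺ (λ (a , b) → T? (toℕ a <ᵇ toℕ b)) (∈-pairs _ _) (<⇒<ᵇ a<b)

data Hop : Set where
  one two : Hop

hopLength : Hop → ℕ
hopLength one = 1
hopLength two = 2

_≟ʰ_ : DecidableEquality Hop
one ≟ʰ one = yes refl
one ≟ʰ two = no λ ()
two ≟ʰ one = no λ ()
two ≟ʰ two = yes refl

open import Data.List.Relation.Unary.Unique.DecPropositional (Product.≡-dec (Fin._≟_ {5}) _≟ʰ_) using (unique?)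

hopLength-injective : ∀ h h′ → hopLength h ≡ hopLength h′ → h ≡ h′
hopLength-injective one one _ = refl
hopLength-injective two two _ = refl

1≤hopLength : ∀ h → 1 ≤ hopLength h
1≤hopLength one = ≤-refl
1≤hopLength two = s≤s z≤n

hopLength≤2 : ∀ h → hopLength h ≤ 2
hopLength≤2 one = s≤s z≤n
hopLength≤2 two = ≤-refl

-- a—b is one of the chords p—p+1, p−1—p+1, p—p+2 (mod s): those passing between p and p+1.
CrossingAt : ℕ → ℕ → ℕ → ℕ → Set
CrossingAt s p a b = (a ≡ p × Rot s 1 p b) ⊎ (Rot s 1 a p × Rot s 1 p b) ⊎ (a ≡ p × Rot s 2 p b)

passes-over : ∀ {s p x y d} → x ≤ p → p < x + d → d ≤ 2 → y < s → Rot s d x y → CrossingAt s p x y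
passes-over {x = x} {d = 0} x≤p p<x _ _ _ = contradiction x≤p (<⇒≱ (subst (_ <_) (+-identityʳ x) p<x))
passes-over {s} {p} {x} {d = 1} x≤p p<x+1 _ _ x→y = inj₁ (x≡p , subst (λ z → Rot s 1 z _) x≡p x→y)
  where
  x≡p : x ≡ p
  x≡p = ≤-antisym x≤p (≤-pred (subst (p <_) (+-comm x 1) p<x+1))
passes-over {s} {p} {x} {d = 2} x≤p p<x+2 _ y<s x→y with x ≟ p
... | yes x≡p = inj₂ (inj₂ (x≡p , subst (λ z → Rot s 2 z _) x≡p x→y))
... | no  x≢p = inj₂ (inj₁ (direct x+1≡p , Rot-cancelˡ (s≤s z≤n) y<s (direct x+1≡p) x→y))
  where
  x+1≡p : x + 1 ≡ p
  x+1≡p = trans (+-comm x 1) (≤-antisym (≤∧≢⇒< x≤p x≢p) (≤-pred (subst (p <_) (+-comm x 2) p<x+2)))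
passes-over {d = suc (suc (suc _))} _ _ (s≤s (s≤s ())) _ _

-- The only way into the arc (g, g′] across s−1 | 0 is the chord s−1 — 1, which passes over g = 0.
wraps-into : ∀ {s g a b d} → g < a → b < s → d ≤ 2 → b + d ≡ a + s → CrossingAt s g b a
wraps-into {s} {g} {a} {b} {0} g<a b<s _ e =
  contradiction (≤-trans (m≤n+m s a) (≤-reflexive (trans (sym e) (+-identityʳ b)))) (<⇒≱ b<s)
wraps-into {s} {g} {a} {b} {1} g<a b<s _ e = contradiction (+-cancelʳ-≤ 1 s b s+1≤b+1) (<⇒≱ b<s)
  where
  open ≤-Reasoning
  s+1≤b+1 : s + 1 ≤ b + 1
  s+1≤b+1 = begin
    s + 1  ≡⟨ +-comm s 1 ⟩
    1 + s  ≤⟨ +-monoˡ-≤ s (≤-trans (s≤s z≤n) g<a) ⟩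
    a + s  ≡⟨ e ⟨
    b + 1  ∎
wraps-into {s} {g} {a} {b} {2} g<a b<s _ e =
  subst₂ (λ g a → CrossingAt s g b a) (sym g≡0) (sym a≡1) (inj₂ (inj₁ (wrap b+1≡s , direct refl)))
  where
  a≡1 : a ≡ 1
  a≡1 = ≤-antisym (+-cancelʳ-≤ s a 1 (≤-trans (≤-reflexive (trans (sym e) (+-comm b 2))) (s≤s b<s)))
                  (≤-trans (s≤s z≤n) g<a)
  g≡0 : g ≡ 0
  g≡0 = n<1⇒n≡0 (subst (g <_) a≡1 g<a)
  b+1≡s : b + 1 ≡ s
  b+1≡s = suc-injective (trans (sym (+-suc b 1)) (trans e (cong (_+ s) a≡1)))
wraps-into {d = suc (suc (suc _))} _ _ (s≤s (s≤s ())) _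

module Arc {s g g′ : ℕ} (g′<s : g′ < s) where

  InArc : ℕ → Set
  InArc x = g < x × x ≤ g′

  leaves-arc : ∀ {a b d} → InArc a → ¬ InArc b → d ≤ 2 → b < s → Rot s d a b → CrossingAt s g′ a b
  leaves-arc {a} {b} {d} (g<a , a≤g′) b∉ d≤2 b<s a→b = passes-over a≤g′ (past-g′ a→b) d≤2 b<s a→b
    where
    past-g′ : Rot s d a b → g′ < a + d
    past-g′ (direct e) = ≰⇒> λ a+d≤g′ → b∉ (<-≤-trans g<a (subst (a ≤_) e (m≤m+n a d)) , subst (_≤ g′) e a+d≤g′)
    past-g′ (wrap e)   = <-≤-trans g′<s (subst (s ≤_) (sym e) (m≤n+m s b))

  enters-arc : ∀ {a b d} → InArc a → ¬ InArc b → d ≤ 2 → a < s → b < s → Rot s d b a → CrossingAt s g b a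
  enters-arc {a} {b} {d} (g<a , a≤g′) b∉ d≤2 a<s _ (direct e) =
    passes-over (≮⇒≥ λ g<b → b∉ (g<b , ≤-trans (subst (b ≤_) e (m≤m+n b d)) a≤g′))
                (subst (g <_) (sym e) g<a) d≤2 a<s (direct e)
  enters-arc (g<a , _) _ d≤2 _ b<s (wrap e) = wraps-into g<a b<s d≤2 e

xor-≡ : ∀ {x y} → x ≡ y → x xor y ≡ false
xor-≡ {x} refl = xor-same x

-- Writing s = 5 + k makes s ∸ 1, s ∸ 2 and the bounds n ≤ s for n ≤ 5 compute.
module CycleSquare (k : ℕ) where

  s : ℕ
  s = 5 + k

  -- Opaque because unfolding next duplicates its argument, so terms like v ⟳ (s ∸ 1) explode.
  opaque
    next : Fin s → Fin s
    next v with suc (toℕ v) <? s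
    ... | yes v+1<s = fromℕ< v+1<s
    ... | no  _     = fromℕ< {0} (s≤s z≤n)

    Rot-next : ∀ v → Rot s 1 (toℕ v) (toℕ (next v))
    Rot-next v with suc (toℕ v) <? s
    ... | yes v+1<s = direct (trans (+-comm (toℕ v) 1) (sym (toℕ-fromℕ< v+1<s)))
    ... | no  v+1≮s = wrap (trans (+-comm (toℕ v) 1) (≤-antisym (toℕ<n v) (≮⇒≥ v+1≮s)))

  infixl 7 _⟳_
  _⟳_ : Fin s → ℕ → Fin s
  v ⟳ zero  = v
  v ⟳ suc t = next (v ⟳ t)

  Rot-⟳ : ∀ v t → t ≤ s → Rot s t (toℕ v) (toℕ (v ⟳ t))
  Rot-⟳ v zero    _   = Rot-zero
  Rot-⟳ v (suc t) t<s = subst (λ d → Rot s d (toℕ v) (toℕ (v ⟳ suc t))) (+-comm t 1)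
    (Rot-compose (toℕ<n v) (subst (_≤ s) (+-comm 1 t) t<s) (Rot-⟳ v t (<⇒≤ t<s)) (Rot-next (v ⟳ t)))

  ⟳-unique : ∀ {v z t} → t ≤ s → Rot s t (toℕ v) (toℕ z) → z ≡ v ⟳ t
  ⟳-unique {v} {z} {t} t≤s v→z = toℕ-injective (Rot-functional (toℕ<n z) (toℕ<n _) v→z (Rot-⟳ v t t≤s))

  ⟳-injective : ∀ {v t t′} → t < s → t′ < s → v ⟳ t ≡ v ⟳ t′ → t ≡ t′
  ⟳-injective {v} {t} {t′} t<s t′<s eq =
    Rot-offset-unique t<s t′<s (Rot-⟳ v t (<⇒≤ t<s)) (subst (λ z → Rot s t′ _ (toℕ z)) (sym eq) (Rot-⟳ v t′ (<⇒≤ t′<s)))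

  1≤s : 1 ≤ s
  1≤s = s≤s z≤n

  2≤s : 2 ≤ s
  2≤s = s≤s (s≤s z≤n)

  2<s : 2 < s
  2<s = s≤s (s≤s (s≤s z≤n))

  Rot-⟳ᵒ : ∀ v {d} → d ≤ s → Rot s d (toℕ (v ⟳ (s ∸ d))) (toℕ v)
  Rot-⟳ᵒ v {d} d≤s = subst (λ e → Rot s e (toℕ (v ⟳ (s ∸ d))) (toℕ v)) (m∸[m∸n]≡n d≤s)
    (Rot-inverse (m∸n≤m s d) (Rot-⟳ v (s ∸ d) (m∸n≤m s d)))

  ⟳ᵒ-unique : ∀ {v z d} → d ≤ s → Rot s d (toℕ z) (toℕ v) → z ≡ v ⟳ (s ∸ d)
  ⟳ᵒ-unique {d = d} d≤s z→v = ⟳-unique (m∸n≤m s d) (Rot-inverse d≤s z→v)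

  -- Regularity

  neighbours : Fin s → List (Fin s)
  neighbours v = v ⟳ 1 ∷ v ⟳ 2 ∷ v ⟳ (s ∸ 1) ∷ v ⟳ (s ∸ 2) ∷ []

  neighbours-unique : ∀ v → Unique (neighbours v)
  neighbours-unique v =
    (distinct 1<s 2<s (λ ()) ∷ distinct 1<s s-1<s (λ ()) ∷ distinct 1<s s-2<s (λ ()) ∷ []) ∷
    (distinct 2<s s-1<s (λ ()) ∷ distinct 2<s s-2<s (λ ()) ∷ []) ∷
    (distinct s-1<s s-2<s (1+n≢n) ∷ []) ∷ [] ∷ []
    where
    distinct : ∀ {t t′} → t < s → t′ < s → t ≢ t′ → v ⟳ t ≢ v ⟳ t′
    distinct t<s t′<s t≢t′ eq = t≢t′ (⟳-injective t<s t′<s eq)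
    1<s : 1 < s
    1<s = s≤s (s≤s z≤n)
    s-1<s : s ∸ 1 < s
    s-1<s = n<1+n _
    s-2<s : s ∸ 2 < s
    s-2<s = m<n⇒m<1+n (n<1+n _)

  C2-neighbours : ∀ {v z} → z ∈ neighbours v → C2 s v z ≡ true
  C2-neighbours {v} (here refl)                         = Ahead⇒C2 2<s (1 , ≤-refl , s≤s z≤n , Rot-⟳ v 1 1≤s)
  C2-neighbours {v} (there (here refl))                 = Ahead⇒C2 2<s (2 , s≤s z≤n , ≤-refl , Rot-⟳ v 2 2≤s)
  C2-neighbours {v} (there (there (here refl)))         = Ahead⇒C2ᵒ 2<s (1 , ≤-refl , s≤s z≤n , Rot-⟳ᵒ v 1≤s)
  C2-neighbours {v} (there (there (there (here refl)))) = Ahead⇒C2ᵒ 2<s (2 , s≤s z≤n , ≤-refl , Rot-⟳ᵒ v 2≤s)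

  C2⇒neighbours : ∀ {v z} → C2 s v z ≡ true → z ∈ neighbours v
  C2⇒neighbours adj with C2⇒Ahead adj
  ... | inj₁ (1 , _ , _ , v→z) = here (⟳-unique 1≤s v→z)
  ... | inj₁ (2 , _ , _ , v→z) = there (here (⟳-unique 2≤s v→z))
  ... | inj₂ (1 , _ , _ , z→v) = there (there (here (⟳ᵒ-unique 1≤s z→v)))
  ... | inj₂ (2 , _ , _ , z→v) = there (there (there (here (⟳ᵒ-unique 2≤s z→v))))
  ... | inj₁ (suc (suc (suc _)) , _ , s≤s (s≤s ()) , _)
  ... | inj₂ (suc (suc (suc _)) , _ , s≤s (s≤s ()) , _)

  C2-regular : Regular (C2 s) 4
  C2-regular v = length-filterᵇ≡ (C2 s v) (allFin⁺ s) (neighbours-unique v)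
    (λ z∈ → ∈-allFin _ , C2-neighbours z∈)
    (λ _ → C2⇒neighbours)

  -- Edge connectivity

  ⟳-+ : ∀ v a b → (v ⟳ a) ⟳ b ≡ v ⟳ (b + a)
  ⟳-+ v a zero    = refl
  ⟳-+ v a (suc b) = cong next (⟳-+ v a b)

  ⟳-period : ∀ v → v ⟳ s ≡ v
  ⟳-period v = sym (⟳-unique ≤-refl (wrap refl))

  offset : ∀ (u v : Fin s) → Σ ℕ λ t → t < s × v ≡ u ⟳ t
  offset u v with toℕ u ≤? toℕ v
  ... | yes u≤v = toℕ v ∸ toℕ u , t<s , ⟳-unique (<⇒≤ t<s) (direct (m+[n∸m]≡n u≤v))
    where
    t<s : toℕ v ∸ toℕ u < s
    t<s = ≤-<-trans (m∸n≤m (toℕ v) (toℕ u)) (toℕ<n v)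
  ... | no  u≰v = toℕ v + s ∸ toℕ u , t<s ,
                  ⟳-unique (<⇒≤ t<s) (wrap (m+[n∸m]≡n (≤-trans (<⇒≤ (toℕ<n u)) (m≤n+m s (toℕ v)))))
    where
    t<s : toℕ v + s ∸ toℕ u < s
    t<s = m<n+o⇒m∸n<o (toℕ v + s) (toℕ u) (+-monoˡ-< s (≰⇒> u≰v))

  module _ {R : Fin s → Fin s → Set} (R-sym : ∀ {u v} → R u v → R v u) (x₀ : Fin s)
           (rim : ∀ y → y ≢ x₀ → Star R y (next y)) where

    rim-walk : ∀ t → t < s → Star R (next x₀) (next x₀ ⟳ t)
    rim-walk zero    _     = ε
    rim-walk (suc t) 1+t<s = rim-walk t (<⇒≤ 1+t<s) ◅◅ rim (next x₀ ⟳ t) returns-early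
      where
      returns-early : next x₀ ⟳ t ≢ x₀
      returns-early eq = 1+n≢0 (⟳-injective 1+t<s (≤-<-trans z≤n 1+t<s) (begin
        x₀ ⟳ suc t    ≡⟨ cong (x₀ ⟳_) (+-comm 1 t) ⟩
        x₀ ⟳ (t + 1)  ≡⟨ ⟳-+ x₀ 1 t ⟨
        x₀ ⟳ 1 ⟳ t    ≡⟨ eq ⟩
        x₀            ∎))
        where open ≡-Reasoning

    rim-connected : ∀ u v → Star R u v
    rim-connected u v with offset (next x₀) u | offset (next x₀) v
    ... | t , t<s , refl | t′ , t′<s , refl = reverse R-sym (rim-walk t t<s) ◅◅ rim-walk t′ t′<s

  isOrigin : Fin s → Bool
  isOrigin i = toℕ i ≡ᵇ 0

  cut₀ : Graph s
  cut₀ i j = C2 s i j ∧ (isOrigin i ∨ isOrigin j)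

  cut₀-spanning : SpanningSubgraph (C2 s) cut₀
  cut₀-spanning = (λ u v → cong₂ _∧_ (C2-sym u v) (∨-comm (isOrigin u) (isOrigin v)))
                , (λ u v → ∧-conicalˡ _ _)

  cut₀-disconnects : ¬ Connected (C2 s ∖ cut₀)
  cut₀-disconnects connected = 1+n≢0 (⟳-injective (s≤s (s≤s z≤n)) (s≤s z≤n) (stuck (connected Fin.zero (Fin.zero ⟳ 1))))
    where
    stuck : ∀ {v} → Star (Adj (C2 s ∖ cut₀)) Fin.zero v → v ≡ Fin.zero
    stuck ε = refl
    stuck (_◅_ {j = j} edge _) = contradiction
      (subst (λ b → not (b ∧ true) ≡ true) (∧-conicalˡ (C2 s Fin.zero j) _ edge) (∧-conicalʳ (C2 s Fin.zero j) _ edge)) λ ()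

  cut₀-size : edgeCount cut₀ ≡ 4
  cut₀-size = trans (edgeCount≡ cut₀)
    (length-filterᵇ≡ (listedEdge cut₀) (pairs-unique s)
      (map⁺ {f = Fin.zero ,_} (cong proj₂) (neighbours-unique Fin.zero)) listed complete)
    where
    listed : ∀ {e} → e ∈ map (Fin.zero ,_) (neighbours Fin.zero) → e ∈ pairs s × listedEdge cut₀ e ≡ true
    listed e∈ with ∈-map⁻ (Fin.zero ,_) e∈
    ... | w , w∈ , refl = ∈-pairs Fin.zero w , cong₂ _∧_ (Equivalence.to T-≡ (<⇒<ᵇ 0<w)) (cong (_∧ true) adj)
      where
      adj : C2 s Fin.zero w ≡ true
      adj = C2-neighbours w∈
      0<w : 0 < toℕ w
      0<w = n≢0⇒n>0 (≢-sym (proj₁ (Equivalence.to C2≡true⇔ adj)))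

    complete : ∀ {e} → e ∈ pairs s → listedEdge cut₀ e ≡ true → e ∈ map (Fin.zero ,_) (neighbours Fin.zero)
    complete {i , j} _ listed = subst (λ v → (v , j) ∈ map (Fin.zero ,_) (neighbours Fin.zero)) (sym i≡0)
      (∈-map⁺ (Fin.zero ,_) (C2⇒neighbours (subst (λ v → C2 s v j ≡ true) i≡0 adj)))
      where
      i<j : toℕ i < toℕ j
      i<j = <ᵇ⇒< _ _ (Equivalence.from T-≡ (∧-conicalˡ (toℕ i <ᵇ toℕ j) (cut₀ i j) listed))
      cut : cut₀ i j ≡ true
      cut = ∧-conicalʳ (toℕ i <ᵇ toℕ j) (cut₀ i j) listed
      adj : C2 s i j ≡ true
      adj = ∧-conicalˡ (C2 s i j) _ cut
      j-not-origin : ∀ {n} → 0 < n → (n ≡ᵇ 0) ≡ false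
      j-not-origin {suc _} _ = refl
      i≡0 : i ≡ Fin.zero
      i≡0 = toℕ-injective (≡ᵇ⇒≡ _ _ (Equivalence.from T-≡ (trans (sym (∨-identityʳ _))
        (subst (λ b → isOrigin i ∨ b ≡ true) (j-not-origin (≤-<-trans z≤n i<j)) (∧-conicalʳ (C2 s i j) _ cut)))))

  hop : Hop → Fin s → Fin s
  hop h v = v ⟳ hopLength h

  Chord : Set
  Chord = Fin s × Hop

  chordEnds : Chord → Fin s × Fin s
  chordEnds (v , h) = v , hop h v

  Rot-hop : ∀ v h → Rot s (hopLength h) (toℕ v) (toℕ (hop h v))
  Rot-hop v one = Rot-⟳ v 1 1≤s
  Rot-hop v two = Rot-⟳ v 2 2≤s

  hop-Ahead : ∀ v h → Ahead s (toℕ v) (toℕ (hop h v))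
  hop-Ahead v h = hopLength h , 1≤hopLength h , hopLength≤2 h , Rot-hop v h

  hop-≢ : ∀ v h → toℕ v ≢ toℕ (hop h v)
  hop-≢ v h = Rot⇒≢ (1≤hopLength h) (≤-<-trans (hopLength≤2 h) 2<s) (Rot-hop v h)

  chordEnds-injective : ∀ {c c′} → orient (chordEnds c) ≡ orient (chordEnds c′) → c ≡ c′
  chordEnds-injective {v , h} {v′ , h′} eq with orient-injective eq
  ... | inj₁ (refl , same-end) = cong (v ,_) (hopLength-injective h h′ (⟳-injective (hop<s h) (hop<s h′) same-end))
    where
    hop<s : ∀ h → hopLength h < s
    hop<s h = ≤-<-trans (hopLength≤2 h) 2<s
  ... | inj₂ (v≡w′ , w≡v′) = contradiction (Rot-offset-unique (s≤s z≤n) (round<s h h′) Rot-zero round-trip)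
    (<⇒≢ (≤-trans (1≤hopLength h) (m≤m+n _ _)))
    where
    round<s : ∀ h h′ → hopLength h + hopLength h′ < s
    round<s h h′ = ≤-<-trans (+-mono-≤ (hopLength≤2 h) (hopLength≤2 h′)) (s≤s (s≤s (s≤s (s≤s (s≤s z≤n)))))
    round-trip : Rot s (hopLength h + hopLength h′) (toℕ v) (toℕ v)
    round-trip = Rot-compose (toℕ<n v) (<⇒≤ (round<s h h′))
      (subst (λ w → Rot s (hopLength h) (toℕ v) (toℕ w)) w≡v′ (Rot-hop v h))
      (subst (λ w → Rot s (hopLength h′) (toℕ v′) (toℕ w)) (sym v≡w′) (Rot-hop v′ h′))

  chords-≤-edgeCount : (F : Graph s) → (∀ u v → F u v ≡ F v u) → (cs : List Chord) → Unique cs →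
                       All (λ (v , h) → F v (hop h v) ≡ true) cs → length cs ≤ edgeCount F
  chords-≤-edgeCount F F-sym cs unique cs⊆F =
    edgeCount-≥ F F-sym chordEnds chordEnds-injective cs unique (All.map (λ {(v , h)} Fvw → hop-≢ v h , Fvw) cs⊆F)

  C2-hop : ∀ v h → C2 s v (hop h v) ≡ true
  C2-hop v h = Ahead⇒C2 2<s (hop-Ahead v h)

  RimFreeExcept : Graph s → Fin s → Set
  RimFreeExcept F x = ∀ z → z ≢ x → F z (next z) ≡ false

  module SmallCut (F : Graph s) (F-sym : ∀ u v → F u v ≡ F v u) (few : edgeCount F < 4) where

    InF : Chord → Set
    InF (v , h) = F v (hop h v) ≡ true

    Free : Chord → Set
    Free (v , h) = F v (hop h v) ≡ false

    free-chord : ∀ c {c₁ c₂ c₃} → Unique (c ∷ c₁ ∷ c₂ ∷ c₃ ∷ []) → InF c₁ → InF c₂ → InF c₃ → Free c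
    free-chord (v , h) unique f₁ f₂ f₃ with F v (hop h v) in f
    ... | false = refl
    ... | true  = contradiction (chords-≤-edgeCount F F-sym _ unique (f ∷ f₁ ∷ f₂ ∷ f₃ ∷ [])) (<⇒≱ few)

    along : ∀ {v} h → Free (v , h) → Adj (C2 s ∖ F) v (hop h v)
    along {v} h free = cong₂ _∧_ (C2-hop v h) (cong not free)

    against : ∀ {v} h → Free (v , h) → Adj (C2 s ∖ F) (hop h v) v
    against {v} h free = cong₂ _∧_ (trans (C2-sym _ v) (C2-hop v h)) (cong not (trans (F-sym _ v) free))

    module Window (c₀ : Fin s) where

      c : ℕ → Fin s
      c i = c₀ ⟳ i

      at : Fin 5 × Hop → Chord
      at (i , h) = c (toℕ i) , h

      at-injective : ∀ {w w′} → at w ≡ at w′ → w ≡ w′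
      at-injective {i , h} {i′ , h′} eq = cong₂ _,_
        (toℕ-injective (⟳-injective (<-≤-trans (toℕ<n i) 5≤s) (<-≤-trans (toℕ<n i′) 5≤s) (cong proj₁ eq)))
        (cong proj₂ eq)
        where
        5≤s : 5 ≤ s
        5≤s = s≤s (s≤s (s≤s (s≤s (s≤s z≤n))))

      window-unique : (ws : List (Fin 5 × Hop)) {distinct : True (unique? ws)} → Unique (map at ws)
      window-unique _ {distinct} = map⁺ at-injective (toWitness distinct)

      via-c₀ : InF (c 2 , one) → InF (c 2 , two) → InF (c 1 , one) → Star (Adj (C2 s ∖ F)) (c 2) (c 3)
      via-c₀ f₁ f₂ f₃ = against two (free (# 0 , two)) ◅ along one (free (# 0 , one)) ◅ along two (free (# 1 , two)) ◅ ε
        where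
        free : ∀ w {distinct : True (unique? (w ∷ (# 2 , one) ∷ (# 2 , two) ∷ (# 1 , one) ∷ []))} → Free (at w)
        free w {distinct} = free-chord (at w) (window-unique (w ∷ _) {distinct}) f₁ f₂ f₃

      via-c₅ : ∀ h → InF (c 2 , one) → InF (c 3 , one) → InF (c 1 , h) → Star (Adj (C2 s ∖ F)) (c 2) (c 3)
      via-c₅ h f₁ f₂ f₃ = along two (free (# 2 , two)) ◅ along one (free (# 4 , one)) ◅ against two (free (# 3 , two)) ◅ ε
        where
        free : ∀ w {distinct : True (unique? (w ∷ (# 2 , one) ∷ (# 3 , one) ∷ (# 1 , h) ∷ []))} → Free (at w)
        free w {distinct} = free-chord (at w) (window-unique (w ∷ _) {distinct}) f₁ f₂ f₃

      rim-free : InF (c 2 , one) → InF (c 2 , two) → InF (c 1 , two) → RimFreeExcept F (c 2)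
      rim-free f₁ f₂ f₃ z z≢c₂ =
        free-chord (z , one) (z-distinct ∷ window-unique ((# 2 , one) ∷ (# 2 , two) ∷ (# 1 , two) ∷ [])) f₁ f₂ f₃
        where
        z-distinct : All ((z , one) ≢_) (map at ((# 2 , one) ∷ (# 2 , two) ∷ (# 1 , two) ∷ []))
        z-distinct = (λ eq → z≢c₂ (cong proj₁ eq)) ∷ (λ ()) ∷ (λ ()) ∷ []

      -- If c₂—c₃ is deleted, either one of the detours through c₄, c₁, c₀ or c₅ survives, or the three
      -- deleted edges are c₂—c₃, c₂—c₄, c₁—c₃ and no other rim edge is deleted.
      c₂-to-c₃ : Star (Adj (C2 s ∖ F)) (c 2) (c 3) ⊎ RimFreeExcept F (c 2)
      c₂-to-c₃ with F (c 2) (c 3) in f23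
      ... | false = inj₁ (along one f23 ◅ ε)
      ... | true with F (c 2) (c 4) in f24 | F (c 3) (c 4) in f34 | F (c 1) (c 2) in f12 | F (c 1) (c 3) in f13
      ... | false | false | _     | _     = inj₁ (along two f24 ◅ against one f34 ◅ ε)
      ... | _     | _     | false | false = inj₁ (against one f12 ◅ along two f13 ◅ ε)
      ... | true  | _     | true  | _     = inj₁ (via-c₀ f23 f24 f12)
      ... | true  | _     | false | true  = inj₂ (rim-free f23 f24 f13)
      ... | false | true  | true  | _     = inj₁ (via-c₅ one f23 f34 f12)
      ... | false | true  | false | true  = inj₁ (via-c₅ two f23 f34 f13)

    ∖-sym : ∀ {u v} → Adj (C2 s ∖ F) u v → Adj (C2 s ∖ F) v u
    ∖-sym {u} {v} adj = trans (cong₂ (λ a b → a ∧ not b) (C2-sym v u) (F-sym v u)) adj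

    rim-or-free : ∀ x → Star (Adj (C2 s ∖ F)) x (next x) ⊎ RimFreeExcept F x
    rim-or-free x = subst (λ y → Star (Adj (C2 s ∖ F)) y (next y) ⊎ RimFreeExcept F y)
      (trans (⟳-+ x (s ∸ 2) 2) (⟳-period x)) (Window.c₂-to-c₃ (x ⟳ (s ∸ 2)))

    connected : Connected (C2 s ∖ F)
    connected with any? (λ x → all? λ z → ¬? (z Fin.≟ x) →-dec (F z (next z) Bool.≟ false))
    ... | yes (x , free) = rim-connected ∖-sym x (λ y y≢x → along one (free y y≢x) ◅ ε)
    ... | no  no-free    = rim-connected ∖-sym Fin.zero
      (λ y _ → [ id , (λ free → contradiction (y , free) no-free) ]′ (rim-or-free y))

  C2-edgeConnectivity : EdgeConnectivity (C2 s) 4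
  C2-edgeConnectivity = (cut₀ , (cut₀-spanning , cut₀-disconnects) , cut₀-size)
                      , λ F ((F-sym , _) , disconnected) → ≮⇒≥ λ few → disconnected (SmallCut.connected F F-sym few)

  -- Connectivity codes

  Signature : Set
  Signature = Bool × Bool × Bool

  signature : Graph s → Fin s → Signature
  signature G p = G p (next p) , G (p ⟳ (s ∸ 1)) (next p) , G p (p ⟳ 2)

  module _ {G G′ : Graph s} (G-span : SpanningSubgraph (C2 s) G) (G′-span : SpanningSubgraph (C2 s) G′) where

    crossing-cancels : ∀ {p u v} → signature G p ≡ signature G′ p →
                       CrossingAt s (toℕ p) (toℕ u) (toℕ v) → (G ⊕ G′) u v ≡ false
    crossing-cancels same (inj₁ (u≡p , p→v)) with toℕ-injective u≡p | ⟳-unique 1≤s p→v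
    ... | refl | refl = xor-≡ (cong proj₁ same)
    crossing-cancels same (inj₂ (inj₁ (u→p , p→v))) with ⟳ᵒ-unique 1≤s u→p | ⟳-unique 1≤s p→v
    ... | refl | refl = xor-≡ (cong (proj₁ ∘ proj₂) same)
    crossing-cancels same (inj₂ (inj₂ (u≡p , p→v))) with toℕ-injective u≡p | ⟳-unique 2≤s p→v
    ... | refl | refl = xor-≡ (cong (proj₂ ∘ proj₂) same)

    ⊕-sym : ∀ u v → (G ⊕ G′) u v ≡ (G ⊕ G′) v u
    ⊕-sym u v = cong₂ _xor_ (proj₁ G-span u v) (proj₁ G′-span u v)

    ⊕-C2 : ∀ {u v} → (G ⊕ G′) u v ≡ true → C2 s u v ≡ true
    ⊕-C2 {u} {v} edge with G u v in Guv
    ... | true  = proj₂ G-span u v Guv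
    ... | false = proj₂ G′-span u v edge

    agreement-disconnects : ∀ {p p′ : Fin s} → toℕ p < toℕ p′ →
                            signature G p ≡ signature G′ p → signature G p′ ≡ signature G′ p′ → ¬ Connected (G ⊕ G′)
    agreement-disconnects {p} {p′} p<p′ same same′ connected =
      trapped (p<p′ , ≤-refl) (λ (p<p , _) → <-irrefl refl p<p) (connected p′ p)
      where
      open Arc {s} {toℕ p} {toℕ p′} (toℕ<n p′)
      trapped : ∀ {u v} → InArc (toℕ u) → ¬ InArc (toℕ v) → ¬ Star (Adj (G ⊕ G′)) u v
      trapped u∈ v∉ ε = v∉ u∈
      trapped {u} u∈ v∉ (_◅_ {j = y} edge walk) with (toℕ p <? toℕ y) ×-dec (toℕ y ≤? toℕ p′)
      ... | yes y∈ = trapped y∈ v∉ walk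
      ... | no  y∉ with C2⇒Ahead (⊕-C2 edge)
      ... | inj₁ (_ , _ , d≤2 , u→y) =
        contradiction (trans (sym edge) (crossing-cancels same′ (leaves-arc u∈ y∉ d≤2 (toℕ<n y) u→y))) λ ()
      ... | inj₂ (_ , _ , d≤2 , y→u) =
        contradiction (trans (sym edge) (trans (⊕-sym u y)
          (crossing-cancels same (enters-arc u∈ y∉ d≤2 (toℕ<n u) (toℕ<n y) y→u)))) λ ()

  signatures : List Signature
  signatures = cartesianProduct bools (cartesianProduct bools bools)

  ∈-signatures : ∀ σ → σ ∈ signatures
  ∈-signatures (x , y , z) = ∈-cartesianProduct⁺ (∈-bools x) (∈-cartesianProduct⁺ (∈-bools y) (∈-bools z))

  nine-graphs-collide : 36 < s → (𝒢 : Fin 9 → Graph s) → (∀ a → SpanningSubgraph (C2 s) (𝒢 a)) →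
                        ∃₂ λ a b → toℕ a < toℕ b × ¬ Connected (𝒢 a ⊕ 𝒢 b)
  nine-graphs-collide 36<s 𝒢 spanning =
    let g₁ , g₂ , g₁<g₂ , same-pair = pigeonhole-∈ (increasingPairs 9) ≤-refl (proj₁ ∘ collision)
                                                   (∈-increasingPairs ∘ proj₁ ∘ proj₂ ∘ collision)
        (a , b) , a<b , same₁ = collision g₁
        same₂ = proj₂ (subst (Collision g₂) (sym same-pair) (proj₂ (collision g₂)))
    in a , b , a<b , agreement-disconnects (spanning a) (spanning b)
                       (subst₂ _<_ (sym (toℕ-inject≤ g₁ 36<s)) (sym (toℕ-inject≤ g₂ 36<s)) g₁<g₂) same₁ same₂
    where
    position : Fin 37 → Fin s
    position g = inject≤ g 36<s
    Collision : Fin 37 → Fin 9 × Fin 9 → Set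
    Collision g (a , b) = toℕ a < toℕ b × signature (𝒢 a) (position g) ≡ signature (𝒢 b) (position g)
    collision : ∀ g → Σ (Fin 9 × Fin 9) (Collision g)
    collision g =
      let a , b , a<b , same = pigeonhole-∈ signatures ≤-refl (λ a → signature (𝒢 a) (position g)) (λ _ → ∈-signatures _)
      in (a , b) , a<b , same

  C2-codeBound : 36 < s → mAtMost (C2 s) 8
  C2-codeBound 36<s m 𝒢 (spanning , separated) = ≮⇒≥ λ 8<m →
    let a , b , a<b , disconnected = nine-graphs-collide 36<s (λ a → 𝒢 (inject≤ a 8<m)) (λ a → spanning (inject≤ a 8<m))
    in disconnected (separated _ _ λ eq → <-irrefl (cong toℕ (inject≤-injective 8<m 8<m a b eq)) a<b)

proposition3p3 : (s : ℕ) → 4 < s →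
    (Regular (C2 s) 4 × EdgeConnectivity (C2 s) 4)
    × (36 < s → mAtMost (C2 s) (2 ^ 3))
proposition3p3 s 4<s with m≤n⇒∃[o]m+o≡n 4<s
... | k , refl = (C2-regular , C2-edgeConnectivity) , C2-codeBound
  where open CycleSquare k
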